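{- Let $\tau$ and $\nu$ be generalized patterns with no hyphens, and let $\phi=\tau\mbox{ - }\ell\mbox{ - }\nu$ be the shuffle pattern consisting of $\tau$, a hyphen, a letter $\ell$, a hyphen, and $\nu$, where $\ell$ is greater than every letter of $\tau$ and of $\nu$, and every letter of $\tau$ is incomparable with every letter of $\nu$. Then for all $k\ge \ell$, $$A_\phi(x;k)=\frac{1}{(1-xA_\tau(x;k-1))(1-xA_\nu(x;k-1))}\Bigl(A_\phi(x;k-1)-xA_\tau(x;k-1)A_\nu(x;k-1)\Bigr).$$
   Context: $[k]=\{1,\dots,k\}$, $[k]^n$ = words of length $n$ over $[k]$. A generalized pattern is a word over $[m]$ using every letter of $[m]$, with possibly hyphens between some consecutive letters. A partially ordered generalized pattern (POGP) has letters from a partially ordered set; a word $\sigma=\sigma_1\cdots\sigma_n$ contains a POGP $\pi=\pi_1\cdots\pi_r$ if there are indices $i_1<\dots<i_r$ such that $i_{j+1}=i_j+1$ whenever $\pi_j,\pi_{j+1}$ are not separated by a hyphen, and for every pair of positions $a,b$ whose letters are comparable (identical letters are equal), $\sigma_{i_a},\sigma_{i_b}$ stand in the same relation ($<$, $=$, $>$) as $\pi_a,\pi_b$; incomparable pairs are unconstrained. Otherwise $\sigma$ avoids $\pi$. For a POGP $\pi$, $A_\pi(x;k)=\sum_{n\ge0}a_\pi(n;k)x^n$ with $a_\pi(n;k)$ the number of words in $[k]^n$ avoiding $\pi$ ($a_\pi(0;k)=1$). Here $\ell$ denotes the integer value of the middle letter of $\phi$. -}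

module Defs where

open import Data.Nat using (ℕ; zero; suc; _+_; _∸_; _≤_; _<_; _≡ᵇ_; _<ᵇ_)
open import Data.Integer as ℤ using (ℤ; +_)
open import Data.Bool using (Bool; true; false; _∧_; _∨_; not; if_then_else_)
open import Data.List using (List; []; _∷_; _++_; length; map; concat; concatMap; take; drop; zip; cartesianProduct; applyUpTo; sum)
open import Data.Bool.ListAction using (all; any)
open import Data.List.Relation.Unary.All using (All)
open import Data.List.Membership.Propositional using (_∈_)
open import Data.Product using (_×_; _,_)
open import Relation.Nullary.Decidable using (does)
open import Data.Nat using (_≤?_)

Word : Set
Word = List ℕ

words : ℕ → ℕ → List Word
words k zero    = [] ∷ []
words k (suc n) = concatMap (λ w → applyUpTo (λ c → suc c ∷ w) k) (words k n)

IsGenPattern : ℕ → Word → Set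
IsGenPattern m τ =
  1 ≤ m × All (λ x → 1 ≤ x × x ≤ m) τ × (∀ i → 1 ≤ i → i ≤ m → i ∈ τ)

-- A POGP with letters in L is given by
--   eqL : decides whether two pattern letters are identical,
--   ltL : the strict partial order on letters (ltL a b = true iff a < b),
--   segs : the list of maximal hyphen-free segments (hyphens separate segments).

-- All candidate occurrences: the values σ_{i_1} … σ_{i_r} for index choices
-- where letters inside a segment are at consecutive positions and each
-- segment starts strictly after the previous one ends.
suffixes : Word → List Word
suffixes []       = [] ∷ []
suffixes (x ∷ xs) = (x ∷ xs) ∷ suffixes xs

occs : {L : Set} → List (List L) → Word → List Word
occs []            σ = [] ∷ []
occs (seg ∷ segs) σ =
  concatMap
    (λ σ' → if does (length seg ≤? length σ')
              then map (λ v → take (length seg) σ' ++ v) (occs segs (drop (length seg) σ'))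
              else [])
    (suffixes σ)

-- the order conditions: identical letters give equal values, and a < b in the
-- poset gives σ-value of a < σ-value of b (the case > is the symmetric pair);
-- incomparable pairs are unconstrained.
respects : {L : Set} → (L → L → Bool) → (L → L → Bool) → List L → Word → Bool
respects eqL ltL ls vs =
  all (λ { ((a , u) , (b , v)) → (not (eqL a b) ∨ (u ≡ᵇ v)) ∧ (not (ltL a b) ∨ (u <ᵇ v)) })
      (cartesianProduct (zip ls vs) (zip ls vs))

contains : {L : Set} → (L → L → Bool) → (L → L → Bool) → List (List L) → Word → Bool
contains eqL ltL segs σ = any (respects eqL ltL (concat segs)) (occs segs σ)

avoidCount : {L : Set} → (L → L → Bool) → (L → L → Bool) → List (List L) → ℕ → ℕ → ℕ
avoidCount eqL ltL segs n k = countB (λ σ → not (contains eqL ltL segs σ)) (words k n)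
  where
    countB : (Word → Bool) → List Word → ℕ
    countB p []       = 0
    countB p (w ∷ ws) = (if p w then 1 else 0) + countB p ws

aGen : Word → ℕ → ℕ → ℕ
aGen τ n k = avoidCount _≡ᵇ_ _<ᵇ_ (τ ∷ []) n k

data PLetter : Set where
  τl : ℕ → PLetter
  ℓl : ℕ → PLetter
  νl : ℕ → PLetter

eqP : PLetter → PLetter → Bool
eqP (τl a) (τl b) = a ≡ᵇ b
eqP (ℓl a) (ℓl b) = a ≡ᵇ b
eqP (νl a) (νl b) = a ≡ᵇ b
eqP _      _      = false

ltP : PLetter → PLetter → Bool
ltP (τl a) (τl b) = a <ᵇ b
ltP (νl a) (νl b) = a <ᵇ b
ltP (τl _) (ℓl _) = true
ltP (νl _) (ℓl _) = true
ltP _      _      = false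

shufflePattern : Word → ℕ → Word → List (List PLetter)
shufflePattern τ ℓ ν = map τl τ ∷ (ℓl ℓ ∷ []) ∷ map νl ν ∷ []

aPhi : Word → ℕ → Word → ℕ → ℕ → ℕ
aPhi τ ℓ ν n k = avoidCount eqP ltP (shufflePattern τ ℓ ν) n k

FPS : Set
FPS = ℕ → ℤ

one : FPS
one zero    = + 1
one (suc _) = + 0

infixl 6 _⊕_ _⊖_
infixl 7 _⊛_

_⊕_ : FPS → FPS → FPS
(f ⊕ g) n = f n ℤ.+ g n

_⊖_ : FPS → FPS → FPS
(f ⊖ g) n = f n ℤ.- g n

X* : FPS → FPS
X* f zero    = + 0
X* f (suc n) = f n

_⊛_ : FPS → FPS → FPS
(f ⊛ g) n = Data.List.foldr ℤ._+_ (+ 0) (applyUpTo (λ i → f i ℤ.* g (n ∸ i)) (suc n))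

-- reciprocal of a series with constant term 1:
-- b₀ = 1, b_{n} = - Σ_{i=1}^{n} f_i b_{n-i}.
-- invRev f n = [b_n, b_{n-1}, …, b_0]
invRev : FPS → ℕ → List ℤ
invRev f zero    = + 1 ∷ []
invRev f (suc n) with invRev f n
... | bs = ℤ.- sumZ (zipIdx bs) ∷ bs
  where
    sumZ : List ℤ → ℤ
    sumZ = Data.List.foldr ℤ._+_ (+ 0)
    -- bs = [b_n,…,b_0]; pair b_{n-j} with f_{j+1}
    zipIdx : List ℤ → List ℤ
    zipIdx xs = go 0 xs
      where
        go : ℕ → List ℤ → List ℤ
        go j []       = []
        go j (b ∷ bs') = f (suc j) ℤ.* b ∷ go (suc j) bs'

headZ : List ℤ → ℤ
headZ []      = + 0
headZ (b ∷ _) = b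

-- 1/f, for f with f 0 = 1
inv : FPS → FPS
inv f n = headZ (invRev f n)

Aτ : Word → ℕ → FPS
Aτ τ k n = + aGen τ n k

Aφ : Word → ℕ → Word → ℕ → FPS
Aφ τ ℓ ν k n = + aPhi τ ℓ ν n k

-- Split a word over [k] at its first letter k, σ = u k v with u a word over [k-1]. The letter k exceeds
-- every letter of τ and ν, so it can serve as ℓ but lies in no occurrence of τ or ν; hence σ contains φ iff
-- u contains φ, or v contains φ, or u contains τ and v contains an occurrence of ν with letters below k.
-- Let B count the words over [k] with no occurrence of ν below k, and Q = A_φ(x;k-1) - A_τ(x;k-1) the words
-- over [k-1] that contain τ but avoid φ. Then
--   A_φ(x;k) = A_φ(x;k-1) + x Q B + x A_τ(x;k-1) A_φ(x;k)   and   B = A_ν(x;k-1) + x A_ν(x;k-1) B,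
-- and eliminating B and Q gives the formula.

module Submission where

open import Defs
open import Data.Nat using (ℕ; _≤_; _<_; _∸_)
open import Relation.Binary.PropositionalEquality using (_≡_)

open import Algebra.Properties.CommutativeSemigroup using (interchange)
open import Data.Bool using (Bool; true; false; not; _∧_; _∨_; if_then_else_)
open import Data.Bool.ListAction using (any; all; or; and)
open import Data.Bool.Properties
  using (T-≡; ∧-comm; ∧-assoc; ∧-zeroʳ; ∧-identityʳ; ∧-distribˡ-∨; ∧-conicalˡ; ∧-conicalʳ; ∨-comm; ∨-assoc; ∨-zeroʳ; ∨-identityʳ)
open import Data.Bool.Solver using (module ∨-∧-Solver)
open import Data.Empty using (⊥-elim)
open import Data.Integer using (ℤ; +_; _+_; _*_; _-_; -_)
import Data.Integer.Properties as ℤ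
open import Data.Integer.Solver using (module +-*-Solver)
open import Data.List using (List; []; _∷_; _++_; length; map; take; drop; zip; foldr; applyUpTo; concatMap; cartesianProduct)
open import Data.List.Properties using (length-map; length-take; length-++-≤ˡ; map-∘; map-cong; ++-identityʳ)
open import Data.List.Relation.Unary.All as All using (All; []; _∷_)
import Data.List.Relation.Unary.All.Properties as All
open import Data.Nat as ℕ using (zero; suc; _<ᵇ_; _≡ᵇ_; _≤?_; _<?_; z≤n; s≤s; s<s)
import Data.Nat.Properties as ℕ
open import Data.Nat.Properties using (<ᵇ⇒<; ≡⇒≡ᵇ; ≤⇒≯; ≰⇒>; ≤-trans; ≤-refl; <⇒≤; m≤n⇒m⊓n≡m; suc-injective)
open import Data.Product using (_×_; _,_; proj₂; map₁)
open import Function using (_∘_; case_of_)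
open import Function.Bundles using (Equivalence)
open import Relation.Nullary using (¬_; Dec; yes; no; does)
open import Relation.Nullary.Decidable using (dec-true; dec-false)
open import Relation.Binary.PropositionalEquality using (_≗_; refl; sym; trans; cong; cong₂; _→-setoid_; module ≡-Reasoning)
import Relation.Binary.Reasoning.Setoid (ℕ →-setoid ℤ) as ≗-Reasoning

module 𝔹-Solver = ∨-∧-Solver using (solve; _:=_; con) renaming (_:+_ to _:∨_; _:*_ to _:∧_)

Σ< : ℕ → (ℕ → ℤ) → ℤ
Σ< n f = foldr _+_ (+ 0) (applyUpTo f n)

Σ<-cong : ∀ n {f g : ℕ → ℤ} → (∀ i → i < n → f i ≡ g i) → Σ< n f ≡ Σ< n g
Σ<-cong zero    f≡g = refl
Σ<-cong (suc n) f≡g = cong₂ _+_ (f≡g 0 (s≤s z≤n)) (Σ<-cong n (λ i i<n → f≡g (suc i) (s≤s i<n)))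

Σ<-zero : ∀ n → Σ< n (λ _ → + 0) ≡ + 0
Σ<-zero zero    = refl
Σ<-zero (suc n) = trans (ℤ.+-identityˡ _) (Σ<-zero n)

Σ<-+ : ∀ n (f g : ℕ → ℤ) → Σ< n (λ i → f i + g i) ≡ Σ< n f + Σ< n g
Σ<-+ zero    f g = refl
Σ<-+ (suc n) f g = trans (cong (_+_ (f 0 + g 0)) (Σ<-+ n (f ∘ suc) (g ∘ suc))) (interchange ℤ.+-commutativeSemigroup (f 0) (g 0) _ _)

Σ<-neg : ∀ n (f : ℕ → ℤ) → Σ< n (λ i → - f i) ≡ - Σ< n f
Σ<-neg zero    f = refl
Σ<-neg (suc n) f = trans (cong (_+_ (- f 0)) (Σ<-neg n (f ∘ suc))) (sym (ℤ.neg-distrib-+ (f 0) _))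

Σ<-*ˡ : ∀ n c (f : ℕ → ℤ) → Σ< n (λ i → c * f i) ≡ c * Σ< n f
Σ<-*ˡ zero    c f = sym (ℤ.*-zeroʳ c)
Σ<-*ˡ (suc n) c f = trans (cong (_+_ (c * f 0)) (Σ<-*ˡ n c (f ∘ suc))) (sym (ℤ.*-distribˡ-+ c (f 0) _))

Σ<-snoc : ∀ n (f : ℕ → ℤ) → Σ< (suc n) f ≡ Σ< n f + f n
Σ<-snoc zero    f = trans (ℤ.+-identityʳ (f 0)) (sym (ℤ.+-identityˡ (f 0)))
Σ<-snoc (suc n) f = trans (cong (_+_ (f 0)) (Σ<-snoc n (f ∘ suc))) (sym (ℤ.+-assoc (f 0) _ _))

Σ<-comm : ∀ m n (f : ℕ → ℕ → ℤ) → Σ< m (λ i → Σ< n (f i)) ≡ Σ< n (λ c → Σ< m (λ i → f i c))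
Σ<-comm zero    n f = sym (Σ<-zero n)
Σ<-comm (suc m) n f = trans (cong (_+_ (Σ< n (f 0))) (Σ<-comm m n (f ∘ suc)))
                            (sym (Σ<-+ n (f 0) (λ c → Σ< m (λ i → f (suc i) c))))

module _ {A : Set} where

  Σ∈ : List A → (A → ℤ) → ℤ
  Σ∈ []       f = + 0
  Σ∈ (x ∷ xs) f = f x + Σ∈ xs f

  Σ∈-cong-All : ∀ {xs} {f g : A → ℤ} → All (λ x → f x ≡ g x) xs → Σ∈ xs f ≡ Σ∈ xs g
  Σ∈-cong-All []           = refl
  Σ∈-cong-All (fx≡gx ∷ eqs) = cong₂ _+_ fx≡gx (Σ∈-cong-All eqs)

  Σ∈-cong : ∀ xs {f g : A → ℤ} → (∀ x → f x ≡ g x) → Σ∈ xs f ≡ Σ∈ xs g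
  Σ∈-cong xs f≗g = Σ∈-cong-All (All.universal f≗g xs)

  Σ∈-+ : ∀ xs (f g : A → ℤ) → Σ∈ xs (λ x → f x + g x) ≡ Σ∈ xs f + Σ∈ xs g
  Σ∈-+ []       f g = refl
  Σ∈-+ (x ∷ xs) f g = trans (cong (_+_ (f x + g x)) (Σ∈-+ xs f g)) (interchange ℤ.+-commutativeSemigroup (f x) (g x) _ _)

  Σ∈-*ˡ : ∀ xs c (f : A → ℤ) → Σ∈ xs (λ x → c * f x) ≡ c * Σ∈ xs f
  Σ∈-*ˡ []       c f = sym (ℤ.*-zeroʳ c)
  Σ∈-*ˡ (x ∷ xs) c f = trans (cong (_+_ (c * f x)) (Σ∈-*ˡ xs c f)) (sym (ℤ.*-distribˡ-+ c (f x) _))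

  Σ∈-*ʳ : ∀ xs c (f : A → ℤ) → Σ∈ xs (λ x → f x * c) ≡ Σ∈ xs f * c
  Σ∈-*ʳ []       c f = sym (ℤ.*-zeroˡ c)
  Σ∈-*ʳ (x ∷ xs) c f = trans (cong (_+_ (f x * c)) (Σ∈-*ʳ xs c f)) (sym (ℤ.*-distribʳ-+ c (f x) _))

  Σ∈-++ : ∀ xs ys (f : A → ℤ) → Σ∈ (xs ++ ys) f ≡ Σ∈ xs f + Σ∈ ys f
  Σ∈-++ []       ys f = sym (ℤ.+-identityˡ _)
  Σ∈-++ (x ∷ xs) ys f = trans (cong (_+_ (f x)) (Σ∈-++ xs ys f)) (sym (ℤ.+-assoc (f x) _ _))

  Σ∈-applyUpTo : ∀ (g : ℕ → A) n f → Σ∈ (applyUpTo g n) f ≡ Σ< n (f ∘ g)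
  Σ∈-applyUpTo g zero    f = refl
  Σ∈-applyUpTo g (suc n) f = cong (_+_ (f (g 0))) (Σ∈-applyUpTo (g ∘ suc) n f)

  Σ∈-Σ< : ∀ xs n (f : A → ℕ → ℤ) → Σ∈ xs (λ x → Σ< n (f x)) ≡ Σ< n (λ i → Σ∈ xs (λ x → f x i))
  Σ∈-Σ< []       n f = sym (Σ<-zero n)
  Σ∈-Σ< (x ∷ xs) n f = trans (cong (_+_ (Σ< n (f x))) (Σ∈-Σ< xs n f))
                             (sym (Σ<-+ n (f x) (λ i → Σ∈ xs (λ y → f y i))))

Σ∈-concatMap : ∀ {A B : Set} (g : A → List B) xs f → Σ∈ (concatMap g xs) f ≡ Σ∈ xs (λ x → Σ∈ (g x) f)
Σ∈-concatMap g []       f = refl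
Σ∈-concatMap g (x ∷ xs) f = trans (Σ∈-++ (g x) (concatMap g xs) f) (cong (_+_ (Σ∈ (g x) f)) (Σ∈-concatMap g xs f))

Σ∈-× : ∀ {A B : Set} xs ys (g : A → ℤ) (h : B → ℤ) → Σ∈ xs (λ u → Σ∈ ys (λ v → g u * h v)) ≡ Σ∈ xs g * Σ∈ ys h
Σ∈-× xs ys g h = trans (Σ∈-cong xs (λ u → Σ∈-*ˡ ys (g u) h)) (Σ∈-*ʳ xs (Σ∈ ys h) g)

shift : FPS → FPS
shift f n = f (suc n)

infixr 7 _·_
_·_ : ℤ → FPS → FPS
(c · f) n = c * f n

⊕-cong : ∀ {f f′ g g′} → f ≗ f′ → g ≗ g′ → f ⊕ g ≗ f′ ⊕ g′
⊕-cong f≗f′ g≗g′ n = cong₂ _+_ (f≗f′ n) (g≗g′ n)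

⊕-congʳ : ∀ f {g g′} → g ≗ g′ → f ⊕ g ≗ f ⊕ g′
⊕-congʳ f = ⊕-cong {f} (λ _ → refl)

⊖-cong : ∀ {f f′ g g′} → f ≗ f′ → g ≗ g′ → f ⊖ g ≗ f′ ⊖ g′
⊖-cong f≗f′ g≗g′ n = cong₂ _-_ (f≗f′ n) (g≗g′ n)

X*-cong : ∀ {f g} → f ≗ g → X* f ≗ X* g
X*-cong f≗g zero    = refl
X*-cong f≗g (suc n) = f≗g n

⊛-cong : ∀ {f f′ g g′} → f ≗ f′ → g ≗ g′ → f ⊛ g ≗ f′ ⊛ g′
⊛-cong f≗f′ g≗g′ n = Σ<-cong (suc n) (λ i _ → cong₂ _*_ (f≗f′ i) (g≗g′ (n ∸ i)))

⊛-congˡ : ∀ {f f′} g → f ≗ f′ → f ⊛ g ≗ f′ ⊛ g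
⊛-congˡ {f} {f′} g f≗f′ = ⊛-cong {f} {f′} {g} {g} f≗f′ (λ _ → refl)

⊛-congʳ : ∀ f {g g′} → g ≗ g′ → f ⊛ g ≗ f ⊛ g′
⊛-congʳ f {g} {g′} = ⊛-cong {f} {f} {g} {g′} (λ _ → refl)

X*-⊕ : ∀ f g → X* (f ⊕ g) ≗ X* f ⊕ X* g
X*-⊕ f g zero    = refl
X*-⊕ f g (suc n) = refl

⊛-unfoldˡ : ∀ f g → f ⊛ g ≗ f 0 · g ⊕ X* (shift f ⊛ g)
⊛-unfoldˡ f g zero    = refl
⊛-unfoldˡ f g (suc n) = refl

⊛-unfoldʳ : ∀ f g n → (f ⊛ g) n ≡ f n * g 0 + X* (f ⊛ shift g) n
⊛-unfoldʳ f g zero    = refl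
⊛-unfoldʳ f g (suc n) = begin
  Σ< (suc (suc n)) (λ i → f i * g (suc n ∸ i))
    ≡⟨ Σ<-snoc (suc n) (λ i → f i * g (suc n ∸ i)) ⟩
  Σ< (suc n) (λ i → f i * g (suc n ∸ i)) + f (suc n) * g (suc n ∸ suc n)
    ≡⟨ cong₂ _+_ (Σ<-cong (suc n) {λ i → f i * g (suc n ∸ i)} (λ i i≤n → cong (λ m → f i * g m) (ℕ.+-∸-assoc 1 (ℕ.≤-pred i≤n))))
                 (cong (λ m → f (suc n) * g m) (ℕ.n∸n≡0 n)) ⟩
  rest + f (suc n) * g 0
    ≡⟨ ℤ.+-comm rest (f (suc n) * g 0) ⟩
  f (suc n) * g 0 + rest
    ∎
  where
  open ≡-Reasoning
  rest : ℤ
  rest = Σ< (suc n) (λ i → f i * g (suc (n ∸ i)))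

⊛-comm : ∀ f g → f ⊛ g ≗ g ⊛ f
⊛-comm f g zero    = cong (_+ + 0) (ℤ.*-comm (f 0) (g 0))
⊛-comm f g (suc n) = begin
  f 0 * g (suc n) + (shift f ⊛ g) n  ≡⟨ cong₂ _+_ (ℤ.*-comm (f 0) (g (suc n))) (⊛-comm (shift f) g n) ⟩
  g (suc n) * f 0 + (g ⊛ shift f) n  ≡⟨ ⊛-unfoldʳ g f (suc n) ⟨
  (g ⊛ f) (suc n)                    ∎
  where open ≡-Reasoning

⊛-distribʳ-⊕ : ∀ f g h → (f ⊕ g) ⊛ h ≗ f ⊛ h ⊕ g ⊛ h
⊛-distribʳ-⊕ f g h n =
  trans (Σ<-cong (suc n) (λ i _ → ℤ.*-distribʳ-+ (h (n ∸ i)) (f i) (g i)))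
        (Σ<-+ (suc n) (λ i → f i * h (n ∸ i)) (λ i → g i * h (n ∸ i)))

⊛-distribˡ-⊕ : ∀ f g h → f ⊛ (g ⊕ h) ≗ f ⊛ g ⊕ f ⊛ h
⊛-distribˡ-⊕ f g h n = begin
  (f ⊛ (g ⊕ h)) n          ≡⟨ ⊛-comm f (g ⊕ h) n ⟩
  ((g ⊕ h) ⊛ f) n          ≡⟨ ⊛-distribʳ-⊕ g h f n ⟩
  (g ⊛ f) n + (h ⊛ f) n    ≡⟨ cong₂ _+_ (⊛-comm g f n) (⊛-comm h f n) ⟩
  (f ⊛ g) n + (f ⊛ h) n    ∎
  where open ≡-Reasoning

⊛-distribʳ-⊖ : ∀ f g h → (f ⊖ g) ⊛ h ≗ f ⊛ h ⊖ g ⊛ h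
⊛-distribʳ-⊖ f g h n = begin
  Σ< (suc n) (λ i → (f i - g i) * h (n ∸ i))
    ≡⟨ Σ<-cong (suc n) (λ i _ → trans (ℤ.*-distribʳ-+ (h (n ∸ i)) (f i) (- g i))
                                      (cong (_+_ (f i * h (n ∸ i))) (sym (ℤ.neg-distribˡ-* (g i) (h (n ∸ i)))))) ⟩
  Σ< (suc n) (λ i → f i * h (n ∸ i) + - (g i * h (n ∸ i)))
    ≡⟨ Σ<-+ (suc n) (λ i → f i * h (n ∸ i)) (λ i → - (g i * h (n ∸ i))) ⟩
  (f ⊛ h) n + Σ< (suc n) (λ i → - (g i * h (n ∸ i)))
    ≡⟨ cong (_+_ ((f ⊛ h) n)) (Σ<-neg (suc n) (λ i → g i * h (n ∸ i))) ⟩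
  (f ⊛ h) n - (g ⊛ h) n
    ∎
  where open ≡-Reasoning

·-⊛ : ∀ c f g → (c · f) ⊛ g ≗ c · (f ⊛ g)
·-⊛ c f g n = trans (Σ<-cong (suc n) (λ i _ → ℤ.*-assoc c (f i) (g (n ∸ i)))) (Σ<-*ˡ (suc n) c (λ i → f i * g (n ∸ i)))

X*-⊛ : ∀ f g → X* f ⊛ g ≗ X* (f ⊛ g)
X*-⊛ f g zero    = refl
X*-⊛ f g (suc n) = ℤ.+-identityˡ _

⊛-X* : ∀ f g → f ⊛ X* g ≗ X* (f ⊛ g)
⊛-X* f g n = begin
  (f ⊛ X* g) n   ≡⟨ ⊛-comm f (X* g) n ⟩
  (X* g ⊛ f) n   ≡⟨ X*-⊛ g f n ⟩
  X* (g ⊛ f) n   ≡⟨ X*-cong (⊛-comm g f) n ⟩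
  X* (f ⊛ g) n   ∎
  where open ≡-Reasoning

one-⊛ : ∀ f → one ⊛ f ≗ f
one-⊛ f zero    = trans (ℤ.+-identityʳ _) (ℤ.*-identityˡ (f 0))
one-⊛ f (suc n) = begin
  + 1 * f (suc n) + Σ< (suc n) (λ i → + 0 * f (n ∸ i))
    ≡⟨ cong₂ _+_ (ℤ.*-identityˡ (f (suc n))) (Σ<-cong (suc n) {λ i → + 0 * f (n ∸ i)} (λ i _ → ℤ.*-zeroˡ (f (n ∸ i)))) ⟩
  f (suc n) + Σ< (suc n) (λ _ → + 0)                   ≡⟨ cong (_+_ (f (suc n))) (Σ<-zero (suc n)) ⟩
  f (suc n) + + 0                                      ≡⟨ ℤ.+-identityʳ _ ⟩
  f (suc n)                                            ∎
  where open ≡-Reasoning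

⊛-assoc : ∀ f g h → (f ⊛ g) ⊛ h ≗ f ⊛ (g ⊛ h)
⊛-assoc f g h n = begin
  ((f ⊛ g) ⊛ h) n                                        ≡⟨ ⊛-congˡ h (⊛-unfoldˡ f g) n ⟩
  ((f 0 · g ⊕ X* (shift f ⊛ g)) ⊛ h) n                   ≡⟨ ⊛-distribʳ-⊕ (f 0 · g) (X* (shift f ⊛ g)) h n ⟩
  ((f 0 · g) ⊛ h) n + (X* (shift f ⊛ g) ⊛ h) n           ≡⟨ cong₂ _+_ (·-⊛ (f 0) g h n) (X*-⊛ (shift f ⊛ g) h n) ⟩
  f 0 * (g ⊛ h) n + X* ((shift f ⊛ g) ⊛ h) n             ≡⟨ cong (_+_ (f 0 * (g ⊛ h) n)) (X*-assoc n) ⟩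
  f 0 * (g ⊛ h) n + X* (shift f ⊛ (g ⊛ h)) n             ≡⟨ ⊛-unfoldˡ f (g ⊛ h) n ⟨
  (f ⊛ (g ⊛ h)) n                                        ∎
  where
  open ≡-Reasoning
  X*-assoc : ∀ n → X* ((shift f ⊛ g) ⊛ h) n ≡ X* (shift f ⊛ (g ⊛ h)) n
  X*-assoc zero    = refl
  X*-assoc (suc m) = ⊛-assoc (shift f) g h m

⊛-leftComm : ∀ f g h → f ⊛ (g ⊛ h) ≗ g ⊛ (f ⊛ h)
⊛-leftComm f g h = begin
  f ⊛ (g ⊛ h)   ≈⟨ ⊛-assoc f g h ⟨
  (f ⊛ g) ⊛ h   ≈⟨ ⊛-congˡ h (⊛-comm f g) ⟩
  (g ⊛ f) ⊛ h   ≈⟨ ⊛-assoc g f h ⟩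
  g ⊛ (f ⊛ h)   ∎
  where open ≗-Reasoning

X*-⊛-Σ< : ∀ f g n → X* (f ⊛ g) n ≡ Σ< n (λ i → f i * g (n ∸ suc i))
X*-⊛-Σ< f g zero    = refl
X*-⊛-Σ< f g (suc n) = refl

mutual
  -- `invRev` forms its sums with a helper local to its definition; abstracting the
  -- list and the start index below turns that helper into a pattern, naming it here.
  invRev-tailSum : FPS → ℕ → List ℤ → ℕ → List ℤ → ℤ
  invRev-tailSum = _

  inv-suc-head : ∀ f n b bs → invRev f n ≡ b ∷ bs →
                 inv f (suc n) ≡ - (f 1 * b + invRev-tailSum f n (b ∷ bs) 1 bs)
  inv-suc-head f n b bs eq rewrite eq with b ∷ bs | 1
  ... | _ | _ = refl

invRev-tailSum-Σ : ∀ f n L j m → invRev-tailSum f n L j (invRev f m)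
                               ≡ Σ< (suc m) (λ i → f (suc (j ℕ.+ i)) * inv f (m ∸ i))
invRev-tailSum-Σ f n L j zero    = cong (λ i → f (suc i) * + 1 + + 0) (sym (ℕ.+-identityʳ j))
invRev-tailSum-Σ f n L j (suc m) = cong₂ _+_
  (cong (λ i → f (suc i) * inv f (suc m)) (sym (ℕ.+-identityʳ j)))
  (trans (invRev-tailSum-Σ f n L (suc j) m)
         (Σ<-cong (suc m) (λ i _ → cong (λ i′ → f (suc i′) * inv f (m ∸ i)) (sym (ℕ.+-suc j i)))))

inv-suc : ∀ f m → inv f (suc m) ≡ - Σ< (suc m) (λ i → f (suc i) * inv f (m ∸ i))
inv-suc f zero    = inv-suc-head f 0 (+ 1) [] refl
inv-suc f (suc m) = trans (inv-suc-head f (suc m) (inv f (suc m)) (invRev f m) refl)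
  (cong (λ s → - (f 1 * inv f (suc m) + s)) (invRev-tailSum-Σ f (suc m) (invRev f (suc m)) 1 m))

⊛-inv : ∀ d → d 0 ≡ + 1 → d ⊛ inv d ≗ one
⊛-inv d d₀≡1 zero    rewrite d₀≡1 = refl
⊛-inv d d₀≡1 (suc m) = begin
  d 0 * inv d (suc m) + s   ≡⟨ cong₂ (λ a b → a * b + s) d₀≡1 (inv-suc d m) ⟩
  + 1 * - s + s             ≡⟨ cong (_+ s) (ℤ.*-identityˡ (- s)) ⟩
  - s + s                   ≡⟨ ℤ.+-inverseˡ s ⟩
  + 0                       ∎
  where
  open ≡-Reasoning
  s : ℤ
  s = Σ< (suc m) (λ i → d (suc i) * inv d (m ∸ i))

d⊛a≗r⇒a≗inv[d]⊛r : ∀ d {a r} → d 0 ≡ + 1 → d ⊛ a ≗ r → a ≗ inv d ⊛ r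
d⊛a≗r⇒a≗inv[d]⊛r d {a} {r} d₀≡1 da≗r = begin
  a                   ≈⟨ one-⊛ a ⟨
  one ⊛ a             ≈⟨ ⊛-congˡ a (⊛-inv d d₀≡1) ⟨
  (d ⊛ inv d) ⊛ a     ≈⟨ ⊛-congˡ a (⊛-comm d (inv d)) ⟩
  (inv d ⊛ d) ⊛ a     ≈⟨ ⊛-assoc (inv d) d a ⟩
  inv d ⊛ (d ⊛ a)     ≈⟨ ⊛-congʳ (inv d) da≗r ⟩
  inv d ⊛ r           ∎
  where open ≗-Reasoning

one-X*-⊛ : ∀ g f → (one ⊖ X* g) ⊛ f ≗ f ⊖ X* (g ⊛ f)
one-X*-⊛ g f n = trans (⊛-distribʳ-⊖ one (X* g) f n) (⊖-cong (one-⊛ f) (X*-⊛ g f) n)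

geometric : ∀ {f h} g → f ≗ h ⊕ X* (g ⊛ f) → (one ⊖ X* g) ⊛ f ≗ h
geometric {f} {h} g f≗h+xgf n = begin
  ((one ⊖ X* g) ⊛ f) n             ≡⟨ one-X*-⊛ g f n ⟩
  f n - X* (g ⊛ f) n               ≡⟨ cong (_- X* (g ⊛ f) n) (f≗h+xgf n) ⟩
  h n + X* (g ⊛ f) n - X* (g ⊛ f) n ≡⟨ solve 2 (λ a b → a :+ b :- b := a) refl (h n) (X* (g ⊛ f) n) ⟩
  h n                              ∎
  where
  open ≡-Reasoning
  open +-*-Solver using (solve; _:+_; _:-_; _:=_)

closedForm : ∀ {a b p q t v} →
  a ≗ p ⊕ X* (q ⊛ b) ⊕ X* (t ⊛ a) → b ≗ v ⊕ X* (v ⊛ b) → p ≗ q ⊕ t →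
  ((one ⊖ X* t) ⊛ (one ⊖ X* v)) ⊛ a ≗ p ⊖ X* (t ⊛ v)
closedForm {a} {b} {p} {q} {t} {v} a-rec b-rec p≗q+t = begin
  (U ⊛ W) ⊛ a                      ≈⟨ ⊛-congˡ a (⊛-comm U W) ⟩
  (W ⊛ U) ⊛ a                      ≈⟨ ⊛-assoc W U a ⟩
  W ⊛ (U ⊛ a)                      ≈⟨ ⊛-congʳ W {g′ = p ⊕ X* (q ⊛ b)} (geometric t a-rec) ⟩
  W ⊛ (p ⊕ X* (q ⊛ b))             ≈⟨ ⊛-distribˡ-⊕ W p (X* (q ⊛ b)) ⟩
  W ⊛ p ⊕ W ⊛ X* (q ⊛ b)           ≈⟨ ⊕-cong (one-X*-⊛ v p) Wxqb≗xqv ⟩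
  p ⊖ X* (v ⊛ p) ⊕ X* (q ⊛ v)      ≈⟨ ⊕-cong (⊖-cong {p} (λ _ → refl) xvp) (λ _ → refl) ⟩
  p ⊖ (X* (q ⊛ v) ⊕ X* (t ⊛ v)) ⊕ X* (q ⊛ v)
    ≈⟨ (λ n → solve 3 (λ x y z → x :- (y :+ z) :+ y := x :- z) refl (p n) (X* (q ⊛ v) n) (X* (t ⊛ v) n)) ⟩
  p ⊖ X* (t ⊛ v)                   ∎
  where
  open ≗-Reasoning
  open +-*-Solver using (solve; _:+_; _:-_; _:=_)
  U = one ⊖ X* t
  W = one ⊖ X* v
  Wxqb≗xqv : W ⊛ X* (q ⊛ b) ≗ X* (q ⊛ v)
  Wxqb≗xqv = begin
    W ⊛ X* (q ⊛ b)    ≈⟨ ⊛-X* W (q ⊛ b) ⟩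
    X* (W ⊛ (q ⊛ b))  ≈⟨ X*-cong (⊛-leftComm W q b) ⟩
    X* (q ⊛ (W ⊛ b))  ≈⟨ X*-cong (⊛-congʳ q (geometric v b-rec)) ⟩
    X* (q ⊛ v)        ∎
  xvp : X* (v ⊛ p) ≗ X* (q ⊛ v) ⊕ X* (t ⊛ v)
  xvp = begin
    X* (v ⊛ p)              ≈⟨ X*-cong (⊛-congʳ v p≗q+t) ⟩
    X* (v ⊛ (q ⊕ t))        ≈⟨ X*-cong (⊛-distribˡ-⊕ v q t) ⟩
    X* (v ⊛ q ⊕ v ⊛ t)      ≈⟨ X*-cong (⊕-cong (⊛-comm v q) (⊛-comm v t)) ⟩
    X* (q ⊛ v ⊕ t ⊛ v)      ≈⟨ X*-⊕ (q ⊛ v) (t ⊛ v) ⟩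
    X* (q ⊛ v) ⊕ X* (t ⊛ v) ∎

𝟙 : Bool → ℤ
𝟙 b = if b then + 1 else + 0

𝟙-not-∨ : ∀ a b → 𝟙 (not (a ∨ b)) ≡ 𝟙 (not a) * 𝟙 (not b)
𝟙-not-∨ true  b = sym (ℤ.*-zeroˡ (𝟙 (not b)))
𝟙-not-∨ false b = sym (ℤ.*-identityˡ (𝟙 (not b)))

𝟙-not-by : ∀ a b → (b ≡ true → a ≡ true) → 𝟙 (not b) ≡ 𝟙 (not b ∧ a) + 𝟙 (not a)
𝟙-not-by false true  b⇒a = case b⇒a refl of λ ()
𝟙-not-by false false _   = refl
𝟙-not-by true  false _   = refl
𝟙-not-by true  true  _   = refl

𝟙-not-split : ∀ a b c d → (b ≡ true → a ≡ true) → (d ≡ true → c ≡ true) →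
              𝟙 (not (b ∨ ((a ∧ c) ∨ d))) ≡ 𝟙 (not b ∧ a) * 𝟙 (not c) + 𝟙 (not a) * 𝟙 (not d)
𝟙-not-split false true  _     _    b⇒a _   = case b⇒a refl of λ ()
𝟙-not-split _     _     false true _   d⇒c = case d⇒c refl of λ ()
𝟙-not-split false false false false _ _ = refl
𝟙-not-split false false true  false _ _ = refl
𝟙-not-split false false true  true  _ _ = refl
𝟙-not-split true  false false false _ _ = refl
𝟙-not-split true  false true  false _ _ = refl
𝟙-not-split true  false true  true  _ _ = refl
𝟙-not-split true  true  false false _ _ = refl
𝟙-not-split true  true  true  false _ _ = refl
𝟙-not-split true  true  true  true  _ _ = refl

mutual
  -- `avoidCount` counts with a helper local to its definition; abstracting `words k n`
  -- in `avoidCount≡countAvoiding` turns that helper into a pattern, naming it here.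
  countAvoiding : ∀ {L : Set} → (L → L → Bool) → (L → L → Bool) → List (List L) → ℕ → ℕ → List Word → ℕ
  countAvoiding = _

  avoidCount≡countAvoiding : ∀ {L : Set} eqL ltL (segs : List (List L)) n k →
                             avoidCount eqL ltL segs n k ≡ countAvoiding eqL ltL segs n k (words k n)
  avoidCount≡countAvoiding eqL ltL segs n k with words k n
  ... | _ = refl

countAvoiding≡Σ𝟙 : ∀ {L : Set} eqL ltL (segs : List (List L)) n k ws →
  + countAvoiding eqL ltL segs n k ws ≡ Σ∈ ws (λ σ → 𝟙 (not (contains eqL ltL segs σ)))
countAvoiding≡Σ𝟙 eqL ltL segs n k []       = refl
countAvoiding≡Σ𝟙 eqL ltL segs n k (w ∷ ws) =
  trans (ℤ.pos-+ (if avoids w then 1 else 0) _) (cong₂ _+_ (𝟙-pos (avoids w)) (countAvoiding≡Σ𝟙 eqL ltL segs n k ws))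
  where
  avoids : Word → Bool
  avoids σ = not (contains eqL ltL segs σ)
  𝟙-pos : ∀ b → + (if b then 1 else 0) ≡ 𝟙 b
  𝟙-pos true  = refl
  𝟙-pos false = refl

avoidCount≡Σ𝟙 : ∀ {L : Set} eqL ltL (segs : List (List L)) n k →
  + avoidCount eqL ltL segs n k ≡ Σ∈ (words k n) (λ σ → 𝟙 (not (contains eqL ltL segs σ)))
avoidCount≡Σ𝟙 eqL ltL segs n k =
  trans (cong +_ (avoidCount≡countAvoiding eqL ltL segs n k)) (countAvoiding≡Σ𝟙 eqL ltL segs n k (words k n))

words-≤ : ∀ k n → All (All (_≤ k)) (words k n)
words-≤ k zero    = [] ∷ []
words-≤ k (suc n) = All.concat⁺ (All.map⁺ (All.map (λ {w} w≤k → All.applyUpTo⁺₁ (λ c → suc c ∷ w) k (_∷ w≤k)) (words-≤ k n)))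

words-< : ∀ j n → All (All (_< suc j)) (words j n)
words-< j n = All.map (All.map s≤s) (words-≤ j n)

Σ∈-words-suc : ∀ k n f → Σ∈ (words k (suc n)) f ≡ Σ∈ (words k n) (λ w → Σ< k (λ c → f (suc c ∷ w)))
Σ∈-words-suc k n f = trans (Σ∈-concatMap (λ w → applyUpTo (λ c → suc c ∷ w) k) (words k n) f)
                           (Σ∈-cong (words k n) (λ w → Σ∈-applyUpTo (λ c → suc c ∷ w) k f))

gf : ℕ → (Word → ℤ) → FPS
gf m f n = Σ∈ (words m n) f

-- The words u (j+1) v of length n, u over [j] and v over [j+1], weighted by F u v.
gfAtTop : ℕ → (Word → Word → ℤ) → FPS
gfAtTop j F n = Σ< n (λ i → Σ∈ (words j i) (λ u → Σ∈ (words (suc j) (n ∸ suc i)) (F u)))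

-- Split a word over [j+1] at its first letter j+1, if any. The induction on n goes through the first
-- letter: j+1 gives the term i = 0, a smaller letter the terms i > 0.
gf-split : ∀ j f → gf (suc j) f ≗ gf j f ⊕ gfAtTop j (λ u v → f (u ++ suc j ∷ v))
gf-split j f zero    = sym (ℤ.+-identityʳ _)
gf-split j f (suc m) = begin
  Σ∈ (words k (suc m)) f
    ≡⟨ Σ∈-words-suc k m f ⟩
  Σ∈ (words k m) (λ w → Σ< k (λ c → f (suc c ∷ w)))
    ≡⟨ Σ∈-cong (words k m) (λ w → Σ<-snoc j (λ c → f (suc c ∷ w))) ⟩
  Σ∈ (words k m) (λ w → Σ< j (λ c → f (suc c ∷ w)) + f (k ∷ w))
    ≡⟨ Σ∈-+ (words k m) (λ w → Σ< j (λ c → f (suc c ∷ w))) (λ w → f (k ∷ w)) ⟩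
  Σ∈ (words k m) (λ w → Σ< j (λ c → f (suc c ∷ w))) + top
    ≡⟨ cong (_+ top) (Σ∈-Σ< (words k m) j (λ w c → f (suc c ∷ w))) ⟩
  Σ< j (λ c → Σ∈ (words k m) (f ∘ (suc c ∷_))) + top
    ≡⟨ cong (_+ top) (Σ<-cong j (λ c _ → gf-split j (f ∘ (suc c ∷_)) m)) ⟩
  Σ< j (λ c → Σ∈ (words j m) (f ∘ (suc c ∷_)) + later c) + top
    ≡⟨ cong (_+ top) (Σ<-+ j (λ c → Σ∈ (words j m) (f ∘ (suc c ∷_))) later) ⟩
  (noTop + Σ< j later) + top
    ≡⟨ solve 3 (λ a b c → (a :+ b) :+ c := a :+ ((c :+ con (+ 0)) :+ b)) refl noTop (Σ< j later) top ⟩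
  noTop + ((top + + 0) + Σ< j later)
    ≡⟨ cong₂ (λ x y → x + ((top + + 0) + y)) noTop≡ later≡ ⟨
  Σ∈ (words j (suc m)) f + Σ< (suc m) (λ i → Σ∈ (words j i) (λ u → Σ∈ (words k (m ∸ i)) (λ v → f (u ++ k ∷ v))))
    ∎
  where
  open ≡-Reasoning
  open +-*-Solver using (solve; _:+_; _:=_; con)
  k : ℕ
  k = suc j
  top : ℤ
  top = Σ∈ (words k m) (λ w → f (k ∷ w))
  later : ℕ → ℤ
  later c = Σ< m (λ i → Σ∈ (words j i) (λ u → Σ∈ (words k (m ∸ suc i)) (λ v → f (suc c ∷ u ++ k ∷ v))))
  noTop : ℤ
  noTop = Σ< j (λ c → Σ∈ (words j m) (f ∘ (suc c ∷_)))
  noTop≡ : Σ∈ (words j (suc m)) f ≡ noTop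
  noTop≡ = trans (Σ∈-words-suc j m f) (Σ∈-Σ< (words j m) j (λ w c → f (suc c ∷ w)))
  later≡ : Σ< m (λ i → Σ∈ (words j (suc i)) (λ u → Σ∈ (words k (m ∸ suc i)) (λ v → f (u ++ k ∷ v)))) ≡ Σ< j later
  later≡ = trans (Σ<-cong m (λ i _ → trans (Σ∈-words-suc j i _)
                                            (Σ∈-Σ< (words j i) j (λ u c → Σ∈ (words k (m ∸ suc i)) (λ v → f (suc c ∷ u ++ k ∷ v))))))
                 (Σ<-comm m j (λ i c → Σ∈ (words j i) (λ u → Σ∈ (words k (m ∸ suc i)) (λ v → f (suc c ∷ u ++ k ∷ v)))))

gf-cong-< : ∀ m {f g} → (∀ {σ} → All (_< suc m) σ → f σ ≡ g σ) → gf m f ≗ gf m g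
gf-cong-< m f≡g n = Σ∈-cong-All (All.map f≡g (words-< m n))

gfAtTop-cong : ∀ j {F G} → (∀ {u v} → All (_< suc j) u → All (_≤ suc j) v → F u v ≡ G u v) → gfAtTop j F ≗ gfAtTop j G
gfAtTop-cong j F≡G n = Σ<-cong n (λ i _ →
  Σ∈-cong-All (All.map (λ u<k → Σ∈-cong-All (All.map (F≡G u<k) (words-≤ (suc j) (n ∸ suc i)))) (words-< j i)))

gfAtTop-+ : ∀ j F G → gfAtTop j (λ u v → F u v + G u v) ≗ gfAtTop j F ⊕ gfAtTop j G
gfAtTop-+ j F G n = trans
  (Σ<-cong n (λ i _ → trans (Σ∈-cong (words j i) (λ u → Σ∈-+ (words (suc j) (n ∸ suc i)) (F u) (G u)))
                            (Σ∈-+ (words j i) (λ u → Σ∈ (words (suc j) (n ∸ suc i)) (F u)) (λ u → Σ∈ (words (suc j) (n ∸ suc i)) (G u)))))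
  (Σ<-+ n _ _)

gfAtTop-* : ∀ j (g h : Word → ℤ) → gfAtTop j (λ u v → g u * h v) ≗ X* (gf j g ⊛ gf (suc j) h)
gfAtTop-* j g h n =
  trans (Σ<-cong n (λ i _ → Σ∈-× (words j i) (words (suc j) (n ∸ suc i)) g h)) (sym (X*-⊛-Σ< (gf j g) (gf (suc j) h) n))

absorbʳ : ∀ a {b} → (b ≡ true → a ≡ true) → a ∨ b ≡ a
absorbʳ a {false} _   = ∨-identityʳ a
absorbʳ a {true}  b⇒a rewrite b⇒a refl = refl

∨-introʳ : ∀ a {b} → b ≡ true → a ∨ b ≡ true
∨-introʳ a refl = ∨-zeroʳ a

any-mono : ∀ {A : Set} {f g : A → Bool} {xs} → All (λ x → f x ≡ true → g x ≡ true) xs →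
           any f xs ≡ true → any g xs ≡ true
any-mono {xs = []}     _              ()
any-mono {f = f} {g} {x ∷ xs} (f⇒g ∷ fs⇒gs) any-f with f x
... | true  = cong (_∨ any g xs) (f⇒g refl)
... | false = ∨-introʳ _ (any-mono fs⇒gs any-f)

any-++ : ∀ {A : Set} (f : A → Bool) xs ys → any f (xs ++ ys) ≡ any f xs ∨ any f ys
any-++ f []       ys = refl
any-++ f (x ∷ xs) ys = trans (cong (f x ∨_) (any-++ f xs ys)) (sym (∨-assoc (f x) _ _))

all-++ : ∀ {A : Set} (f : A → Bool) xs ys → all f (xs ++ ys) ≡ all f xs ∧ all f ys
all-++ f []       ys = refl
all-++ f (x ∷ xs) ys = trans (cong (f x ∧_) (all-++ f xs ys)) (sym (∧-assoc (f x) _ _))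

any-cong : ∀ {A : Set} {f g : A → Bool} → (∀ x → f x ≡ g x) → ∀ xs → any f xs ≡ any g xs
any-cong f≗g xs = cong or (map-cong f≗g xs)

all-cong : ∀ {A : Set} {f g : A → Bool} → (∀ x → f x ≡ g x) → ∀ xs → all f xs ≡ all g xs
all-cong f≗g xs = cong and (map-cong f≗g xs)

any-map : ∀ {A B : Set} (f : B → Bool) (h : A → B) xs → any f (map h xs) ≡ any (f ∘ h) xs
any-map f h xs = cong or (sym (map-∘ xs))

all-map : ∀ {A B : Set} (f : B → Bool) (h : A → B) xs → all f (map h xs) ≡ all (f ∘ h) xs
all-map f h xs = cong and (sym (map-∘ xs))

any-concatMap : ∀ {A B : Set} (f : B → Bool) (g : A → List B) xs → any f (concatMap g xs) ≡ any (any f ∘ g) xs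
any-concatMap f g []       = refl
any-concatMap f g (x ∷ xs) = trans (any-++ f (g x) (concatMap g xs)) (cong (any f (g x) ∨_) (any-concatMap f g xs))

any-if : ∀ {A : Set} (f : A → Bool) b xs → any f (if b then xs else []) ≡ b ∧ any f xs
any-if f true  xs = refl
any-if f false xs = refl

any-∧ˡ : ∀ {A : Set} a (f : A → Bool) xs → any (λ x → a ∧ f x) xs ≡ a ∧ any f xs
any-∧ˡ a f []       = sym (∧-zeroʳ a)
any-∧ˡ a f (x ∷ xs) = trans (cong ((a ∧ f x) ∨_) (any-∧ˡ a f xs)) (sym (∧-distribˡ-∨ a (f x) (any f xs)))

all-∧ : ∀ {A : Set} (f g : A → Bool) xs → all (λ x → f x ∧ g x) xs ≡ all f xs ∧ all g xs
all-∧ f g []       = refl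
all-∧ f g (x ∷ xs) = trans (cong ((f x ∧ g x) ∧_) (all-∧ f g xs))
  (solve 4 (λ a b c d → (a :∧ b) :∧ (c :∧ d) := (a :∧ c) :∧ (b :∧ d)) refl (f x) (g x) (all f xs) (all g xs))
  where open 𝔹-Solver

all-true : ∀ {A : Set} (xs : List A) → all (λ _ → true) xs ≡ true
all-true []       = refl
all-true (x ∷ xs) = all-true xs

all-cartesianProduct : ∀ {A B : Set} (g : A × B → Bool) xs ys →
  all g (cartesianProduct xs ys) ≡ all (λ x → all (λ y → g (x , y)) ys) xs
all-cartesianProduct g []       ys = refl
all-cartesianProduct g (x ∷ xs) ys =
  trans (all-++ g (map (x ,_) ys) (cartesianProduct xs ys)) (cong₂ _∧_ (all-map g (x ,_) ys) (all-cartesianProduct g xs ys))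

take-++-≤ : ∀ {A : Set} n (w x : List A) → n ≤ length w → take n (w ++ x) ≡ take n w
take-++-≤ zero    w       x _         = refl
take-++-≤ (suc n) (y ∷ w) x (s≤s n≤) = cong (y ∷_) (take-++-≤ n w x n≤)

drop-++-≤ : ∀ {A : Set} n (w x : List A) → n ≤ length w → drop n (w ++ x) ≡ drop n w ++ x
drop-++-≤ zero    w       x _         = refl
drop-++-≤ (suc n) (y ∷ w) x (s≤s n≤) = drop-++-≤ n w x n≤

length-take-≤ : ∀ {A : Set} {n} (σ : List A) → n ≤ length σ → length (take n σ) ≡ n
length-take-≤ {n = n} σ n≤ = trans (length-take n σ) (m≤n⇒m⊓n≡m n≤)

zip-++ : ∀ {A B : Set} (xs : List A) (ys : List B) {xs′ ys′} → length xs ≡ length ys →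
         zip (xs ++ xs′) (ys ++ ys′) ≡ zip xs ys ++ zip xs′ ys′
zip-++ []       []       _   = refl
zip-++ (x ∷ xs) (y ∷ ys) len = cong ((x , y) ∷_) (zip-++ xs ys (suc-injective len))

zip-mapˡ : ∀ {A B C : Set} (f : A → C) xs (ys : List B) → zip (map f xs) ys ≡ map (map₁ f) (zip xs ys)
zip-mapˡ f []       ys       = refl
zip-mapˡ f (x ∷ xs) []       = refl
zip-mapˡ f (x ∷ xs) (y ∷ ys) = cong ((f x , y) ∷_) (zip-mapˡ f xs ys)

all-zip-proj₂ : ∀ {A B : Set} (f : B → Bool) (xs : List A) ys → length xs ≡ length ys →
                all (f ∘ proj₂) (zip xs ys) ≡ all f ys
all-zip-proj₂ f []       []       _   = refl
all-zip-proj₂ f (x ∷ xs) (y ∷ ys) len = cong (f y ∧_) (all-zip-proj₂ f xs ys (suc-injective len))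

fits : ℕ → Word → Bool
fits p σ = does (p ≤? length σ)

startsWith : ℕ → (Word → Bool) → Word → Bool
startsWith p m σ = fits p σ ∧ m (take p σ)

anySuffix : (Word → Bool) → Word → Bool
anySuffix f σ = any f (suffixes σ)

below : ℕ → Word → Bool
below c = all (_<ᵇ c)

fits-yes : ∀ {p} σ → p ≤ length σ → fits p σ ≡ true
fits-yes {p} σ p≤ = dec-true (p ≤? length σ) p≤

fits-no : ∀ {p} σ → ¬ p ≤ length σ → fits p σ ≡ false
fits-no {p} σ p≰ = dec-false (p ≤? length σ) p≰

anySuffix-drop : ∀ f n σ → anySuffix f (drop n σ) ≡ true → anySuffix f σ ≡ true
anySuffix-drop f zero    σ       h = h
anySuffix-drop f (suc n) []      h = h
anySuffix-drop f (suc n) (x ∷ σ) h = ∨-introʳ (f (x ∷ σ)) (anySuffix-drop f n σ h)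

below-< : ∀ {c t} → All (_< c) t → below c t ≡ true
below-< []           = refl
below-< {c} {x ∷ _} (x<c ∷ t<c) = cong₂ _∧_ (dec-true (x <? c) x<c) (below-< t<c)

below⇒< : ∀ {c} t → below c t ≡ true → All (_< c) t
below⇒< []      _ = []
below⇒< {c} (x ∷ t) h =
  <ᵇ⇒< x c (Equivalence.from T-≡ (∧-conicalˡ _ _ h)) ∷ below⇒< t (∧-conicalʳ (x <ᵇ c) _ h)

below-mono : ∀ {c c′} t → c ≤ c′ → below c t ≡ true → below c′ t ≡ true
below-mono t c≤c′ h = below-< (All.map (λ x<c → ≤-trans x<c c≤c′) (below⇒< t h))


below-take-hit : ∀ {c k} n w v → c ≤ k → length w < n → below c (take n (w ++ k ∷ v)) ≡ false
below-take-hit {c} {k} (suc n) []      v c≤k _           = cong (_∧ below c (take n v)) (dec-false (k <? c) (≤⇒≯ c≤k))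
below-take-hit {c}     (suc n) (x ∷ w) v c≤k (s<s |w|<n) =
  trans (cong ((x <ᵇ c) ∧_) (below-take-hit n w v c≤k |w|<n)) (∧-zeroʳ (x <ᵇ c))

-- Blocks of lengths p and q are recognised by mτ and mν. `hasν< c σ`: σ contains the ν-block with all
-- letters below c; `mid t ρ`: ρ contains a letter c above every letter of t, followed later by such a
-- ν-block. So `hasφ` is containment of τ-ℓ-ν, ℓ above the letters of τ and ν, τ unrelated to ν.
module Shuffle (p q : ℕ) (mτ mν : Word → Bool) where

  atν< : ℕ → Word → Bool
  atν< c = startsWith q (λ s → mν s ∧ below c s)

  hasν< : ℕ → Word → Bool
  hasν< c = anySuffix (atν< c)

  hasν : Word → Bool
  hasν = anySuffix (startsWith q mν)

  atτ : Word → Bool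
  atτ = startsWith p mτ

  hasτ : Word → Bool
  hasτ = anySuffix atτ

  midAt : Word → Word → Bool
  midAt t []      = false
  midAt t (c ∷ r) = below c t ∧ hasν< c r

  mid : Word → Word → Bool
  mid t = anySuffix (midAt t)

  atφ : Word → Bool
  atφ σ = fits p σ ∧ (mτ (take p σ) ∧ mid (take p σ) (drop p σ))

  hasφ : Word → Bool
  hasφ = anySuffix atφ

  atν<-++-top : ∀ {c k} w v → c ≤ k → atν< c (w ++ k ∷ v) ≡ atν< c w
  atν<-++-top {c} {k} w v c≤k = by-cases (q ≤? length w)
    where
    wkv = w ++ k ∷ v
    by-cases : Dec (q ≤ length w) → atν< c wkv ≡ atν< c w
    by-cases (yes q≤) = cong₂ (λ b s → b ∧ (mν s ∧ below c s))
                              (trans (fits-yes wkv (≤-trans q≤ (length-++-≤ˡ w))) (sym (fits-yes w q≤)))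
                              (take-++-≤ q w (k ∷ v) q≤)
    by-cases (no q≰) = begin
      fits q wkv ∧ (mν (take q wkv) ∧ below c (take q wkv))
        ≡⟨ cong (λ b → fits q wkv ∧ (mν (take q wkv) ∧ b)) (below-take-hit q w v c≤k (≰⇒> q≰)) ⟩
      fits q wkv ∧ (mν (take q wkv) ∧ false)
        ≡⟨ trans (cong (fits q wkv ∧_) (∧-zeroʳ _)) (∧-zeroʳ _) ⟩
      false
        ≡⟨ cong (_∧ (mν (take q w) ∧ below c (take q w))) (fits-no w q≰) ⟨
      fits q w ∧ (mν (take q w) ∧ below c (take q w))
        ∎
      where open ≡-Reasoning

  hasν<-++-top : ∀ {c k} u v → c ≤ k → hasν< c (u ++ k ∷ v) ≡ hasν< c u ∨ hasν< c v
  hasν<-++-top {c} []      v c≤k = cong (_∨ hasν< c v) (trans (atν<-++-top [] v c≤k) (sym (∨-identityʳ _)))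
  hasν<-++-top {c} (x ∷ u) v c≤k =
    trans (cong₂ _∨_ (atν<-++-top (x ∷ u) v c≤k) (hasν<-++-top u v c≤k))
          (sym (∨-assoc (atν< c (x ∷ u)) (hasν< c u) (hasν< c v)))

  atν<-below : ∀ {k} σ → All (_< k) σ → atν< k σ ≡ startsWith q mν σ
  atν<-below σ σ<k = cong (fits q σ ∧_) (trans (cong (mν (take q σ) ∧_) (below-< (All.take⁺ q σ<k))) (∧-identityʳ _))

  hasν<-below : ∀ {k} u → All (_< k) u → hasν< k u ≡ hasν u
  hasν<-below {k} []      []          = cong (_∨ false) (atν<-below {k} [] [])
  hasν<-below (x ∷ u) (x<k ∷ u<k) = cong₂ _∨_ (atν<-below (x ∷ u) (x<k ∷ u<k)) (hasν<-below u u<k)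

  atν<-mono : ∀ {c c′} σ → c ≤ c′ → atν< c σ ≡ true → atν< c′ σ ≡ true
  atν<-mono {c} σ c≤c′ h = cong₂ _∧_ (∧-conicalˡ (fits q σ) _ h)
    (cong₂ _∧_ (∧-conicalˡ (mν s) _ in-block) (below-mono s c≤c′ (∧-conicalʳ (mν s) _ in-block)))
    where
    s : Word
    s = take q σ
    in-block : mν s ∧ below c s ≡ true
    in-block = ∧-conicalʳ (fits q σ) _ h

  hasν<-mono : ∀ {c c′} ρ → c ≤ c′ → hasν< c ρ ≡ true → hasν< c′ ρ ≡ true
  hasν<-mono ρ c≤c′ = any-mono (All.universal (λ σ → atν<-mono σ c≤c′) (suffixes ρ))

  mid⇒hasν< : ∀ {k} t ρ → All (_≤ k) ρ → mid t ρ ≡ true → hasν< k ρ ≡ true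
  mid⇒hasν< t []      _           ()
  mid⇒hasν< t (c ∷ r) (c≤k ∷ r≤k) h with below c t ∧ hasν< c r in at-c
  ... | true  = ∨-introʳ _ (hasν<-mono r c≤k (∧-conicalʳ (below c t) _ at-c))
  ... | false = ∨-introʳ _ (mid⇒hasν< t r r≤k h)

  atφ⇒hasν< : ∀ {k} σ → All (_≤ k) σ → atφ σ ≡ true → hasν< k σ ≡ true
  atφ⇒hasν< σ σ≤k h = anySuffix-drop _ p σ (mid⇒hasν< t (drop p σ) (All.drop⁺ p σ≤k) mid≡)
    where
    t : Word
    t = take p σ
    mid≡ : mid t (drop p σ) ≡ true
    mid≡ = ∧-conicalʳ (mτ t) _ (∧-conicalʳ (fits p σ) _ h)

  hasφ⇒hasν< : ∀ {k} σ → All (_≤ k) σ → hasφ σ ≡ true → hasν< k σ ≡ true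
  hasφ⇒hasν< {k} [] [] h with atφ [] in at
  ... | true = atφ⇒hasν< {k} [] [] at
  hasφ⇒hasν< (x ∷ σ) xσ≤k@(_ ∷ σ≤k) h with atφ (x ∷ σ) in at
  ... | true  = atφ⇒hasν< (x ∷ σ) xσ≤k at
  ... | false = ∨-introʳ _ (hasφ⇒hasν< σ σ≤k h)

  hasφ⇒hasτ : ∀ σ → hasφ σ ≡ true → hasτ σ ≡ true
  hasφ⇒hasτ σ = any-mono (All.universal atφ⇒atτ (suffixes σ))
    where
    atφ⇒atτ : ∀ σ → atφ σ ≡ true → atτ σ ≡ true
    atφ⇒atτ σ h = cong₂ _∧_ (∧-conicalˡ (fits p σ) _ h) (∧-conicalˡ (mτ (take p σ)) _ (∧-conicalʳ (fits p σ) _ h))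

  mid-none : ∀ {k} t ρ → (∀ c → c ≤ k → below c t ≡ false) → All (_≤ k) ρ → mid t ρ ≡ false
  mid-none t []      _     _           = refl
  mid-none t (c ∷ r) t≮ (c≤k ∷ r≤k) =
    trans (cong (λ b → (b ∧ hasν< c r) ∨ mid t r) (t≮ c c≤k)) (mid-none t r t≮ r≤k)

  mid-++-top : ∀ {k} t w v → All (_< k) t → All (_< k) w → All (_≤ k) v →
               mid t (w ++ k ∷ v) ≡ mid t w ∨ hasν< k v
  mid-++-top {k} t [] v t<k _ v≤k = begin
    (below k t ∧ hasν< k v) ∨ mid t v   ≡⟨ cong (λ b → (b ∧ hasν< k v) ∨ mid t v) (below-< t<k) ⟩
    hasν< k v ∨ mid t v                 ≡⟨ absorbʳ (hasν< k v) (mid⇒hasν< t v v≤k) ⟩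
    hasν< k v                           ∎
    where open ≡-Reasoning
  mid-++-top {k} t (c ∷ w) v t<k (c<k ∷ w<k) v≤k = begin
    (b ∧ hasν< c (w ++ k ∷ v)) ∨ mid t (w ++ k ∷ v)
      ≡⟨ cong₂ (λ x y → (b ∧ x) ∨ y) (hasν<-++-top w v (<⇒≤ c<k)) (mid-++-top t w v t<k w<k v≤k) ⟩
    (b ∧ (hasν< c w ∨ hasν< c v)) ∨ (mid t w ∨ hasν< k v)
      ≡⟨ solve 5 (λ b x y m z → (b :∧ (x :∨ y)) :∨ (m :∨ z) := ((b :∧ x) :∨ m) :∨ ((b :∧ y) :∨ z)) refl
               b (hasν< c w) (hasν< c v) (mid t w) (hasν< k v) ⟩
    ((b ∧ hasν< c w) ∨ mid t w) ∨ ((b ∧ hasν< c v) ∨ hasν< k v)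
      ≡⟨ cong (((b ∧ hasν< c w) ∨ mid t w) ∨_) (trans (∨-comm (b ∧ hasν< c v) (hasν< k v)) (absorbʳ (hasν< k v) hit⇒hasν<)) ⟩
    ((b ∧ hasν< c w) ∨ mid t w) ∨ hasν< k v
      ∎
    where
    open ≡-Reasoning
    open 𝔹-Solver
    b = below c t
    hit⇒hasν< : b ∧ hasν< c v ≡ true → hasν< k v ≡ true
    hit⇒hasν< h = hasν<-mono v (<⇒≤ c<k) (∧-conicalʳ b _ h)

  atφ-++-top : ∀ {k} w v → All (_< k) w → All (_≤ k) v → atφ (w ++ k ∷ v) ≡ atφ w ∨ (atτ w ∧ hasν< k v)
  atφ-++-top {k} w v w<k v≤k = by-cases (p ≤? length w)
    where
    wkv = w ++ k ∷ v
    t = take p w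
    by-cases : Dec (p ≤ length w) → atφ wkv ≡ atφ w ∨ (atτ w ∧ hasν< k v)
    by-cases (yes p≤) = begin
      fits p wkv ∧ (mτ (take p wkv) ∧ mid (take p wkv) (drop p wkv))
        ≡⟨ cong₂ (λ b s → b ∧ (mτ s ∧ mid s (drop p wkv)))
                 (trans (fits-yes wkv (≤-trans p≤ (length-++-≤ˡ w))) (sym (fits-yes w p≤)))
                 (take-++-≤ p w (k ∷ v) p≤) ⟩
      fits p w ∧ (mτ t ∧ mid t (drop p wkv))
        ≡⟨ cong (λ r → fits p w ∧ (mτ t ∧ mid t r)) (drop-++-≤ p w (k ∷ v) p≤) ⟩
      fits p w ∧ (mτ t ∧ mid t (drop p w ++ k ∷ v))
        ≡⟨ cong (λ x → fits p w ∧ (mτ t ∧ x)) (mid-++-top t (drop p w) v (All.take⁺ p w<k) (All.drop⁺ p w<k) v≤k) ⟩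
      fits p w ∧ (mτ t ∧ (mid t (drop p w) ∨ hasν< k v))
        ≡⟨ solve 4 (λ f m x y → f :∧ (m :∧ (x :∨ y)) := (f :∧ (m :∧ x)) :∨ ((f :∧ m) :∧ y)) refl
                 (fits p w) (mτ t) (mid t (drop p w)) (hasν< k v) ⟩
      atφ w ∨ (atτ w ∧ hasν< k v)
        ∎
      where
      open ≡-Reasoning
      open 𝔹-Solver
    by-cases (no p≰) = begin
      fits p wkv ∧ (mτ (take p wkv) ∧ mid (take p wkv) (drop p wkv))
        ≡⟨ cong (λ x → fits p wkv ∧ (mτ (take p wkv) ∧ x)) (mid-none (take p wkv) (drop p wkv) τ-hits-k (All.drop⁺ p wkv≤k)) ⟩
      fits p wkv ∧ (mτ (take p wkv) ∧ false)
        ≡⟨ trans (cong (fits p wkv ∧_) (∧-zeroʳ _)) (∧-zeroʳ _) ⟩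
      false
        ≡⟨ cong (λ b → (b ∧ (mτ t ∧ mid t (drop p w))) ∨ ((b ∧ mτ t) ∧ hasν< k v)) (fits-no w p≰) ⟨
      atφ w ∨ (atτ w ∧ hasν< k v)
        ∎
      where
      open ≡-Reasoning
      τ-hits-k : ∀ c → c ≤ k → below c (take p wkv) ≡ false
      τ-hits-k c c≤k = below-take-hit p w v c≤k (≰⇒> p≰)
      wkv≤k : All (_≤ k) wkv
      wkv≤k = All.++⁺ (All.map <⇒≤ w<k) (≤-refl ∷ v≤k)

  hasφ-++-top : ∀ {k} u v → All (_< k) u → All (_≤ k) v →
                hasφ (u ++ k ∷ v) ≡ hasφ u ∨ ((hasτ u ∧ hasν< k v) ∨ hasφ v)
  hasφ-++-top {k} [] v [] v≤k =
    trans (cong (_∨ hasφ v) (atφ-++-top [] v [] v≤k))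
          (solve 4 (λ a t b f → (a :∨ (t :∧ b)) :∨ f := (a :∨ con false) :∨ (((t :∨ con false) :∧ b) :∨ f)) refl
                 (atφ []) (atτ []) (hasν< k v) (hasφ v))
    where open 𝔹-Solver
  hasφ-++-top {k} (x ∷ u) v xu<k@(_ ∷ u<k) v≤k =
    trans (cong₂ _∨_ (atφ-++-top (x ∷ u) v xu<k v≤k) (hasφ-++-top u v u<k v≤k))
          (solve 6 (λ a₁ a₂ b c₁ c₂ d → (a₁ :∨ (a₂ :∧ b)) :∨ (c₁ :∨ ((c₂ :∧ b) :∨ d))
                                      := (a₁ :∨ c₁) :∨ (((a₂ :∨ c₂) :∧ b) :∨ d)) refl
                 (atφ (x ∷ u)) (atτ (x ∷ u)) (hasν< k v) (hasφ u) (hasτ u) (hasφ v))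
    where open 𝔹-Solver

  𝟙-avoidsφ-++-top : ∀ {k} u v → All (_< k) u → All (_≤ k) v →
    𝟙 (not (hasφ (u ++ k ∷ v))) ≡ 𝟙 (not (hasφ u) ∧ hasτ u) * 𝟙 (not (hasν< k v)) + 𝟙 (not (hasτ u)) * 𝟙 (not (hasφ v))
  𝟙-avoidsφ-++-top {k} u v u<k v≤k =
    trans (cong (𝟙 ∘ not) (hasφ-++-top u v u<k v≤k))
          (𝟙-not-split (hasτ u) (hasφ u) (hasν< k v) (hasφ v) (hasφ⇒hasτ u) (hasφ⇒hasν< v v≤k))

  𝟙-avoidsν<-++-top : ∀ {k} u v → All (_< k) u →
    𝟙 (not (hasν< k (u ++ k ∷ v))) ≡ 𝟙 (not (hasν u)) * 𝟙 (not (hasν< k v))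
  𝟙-avoidsν<-++-top {k} u v u<k =
    trans (cong (𝟙 ∘ not) (trans (hasν<-++-top u v ≤-refl) (cong (_∨ hasν< k v) (hasν<-below u u<k))))
          (𝟙-not-∨ (hasν u) (hasν< k v))

  𝟙-avoidsφ : ∀ u → 𝟙 (not (hasφ u)) ≡ 𝟙 (not (hasφ u) ∧ hasτ u) + 𝟙 (not (hasτ u))
  𝟙-avoidsφ u = 𝟙-not-by (hasτ u) (hasφ u) (hasφ⇒hasτ u)

occs-∷ : ∀ {L : Set} (R : Word → Bool) (seg : List L) segs σ →
  any R (occs (seg ∷ segs) σ) ≡
  anySuffix (λ σ′ → fits (length seg) σ′ ∧ any (λ v → R (take (length seg) σ′ ++ v)) (occs segs (drop (length seg) σ′))) σ
occs-∷ R seg segs σ = trans (any-concatMap R _ (suffixes σ)) (any-cong (λ σ′ →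
  trans (any-if R (fits (length seg) σ′) _)
        (cong (fits (length seg) σ′ ∧_) (any-map R (λ v → take (length seg) σ′ ++ v) (occs segs (drop (length seg) σ′)))))
  (suffixes σ))

matches : Word → Word → Bool
matches τ = respects _≡ᵇ_ _<ᵇ_ τ

contains-block : ∀ τ σ → contains _≡ᵇ_ _<ᵇ_ (τ ∷ []) σ ≡ anySuffix (startsWith (length τ) (matches τ)) σ
contains-block τ σ = trans (occs-∷ (respects _≡ᵇ_ _<ᵇ_ (τ ++ [])) τ [] σ) (any-cong (λ σ′ →
  cong (fits (length τ) σ′ ∧_) (trans (∨-identityʳ _) (cong₂ (respects _≡ᵇ_ _<ᵇ_) (++-identityʳ τ) (++-identityʳ _))))
  (suffixes σ))

pairCheck : ∀ {L : Set} → (L → L → Bool) → (L → L → Bool) → L × ℕ → L × ℕ → Bool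
pairCheck eqL ltL (a , u) (b , v) = (not (eqL a b) ∨ (u ≡ᵇ v)) ∧ (not (ltL a b) ∨ (u <ᵇ v))

allPairs : ∀ {A : Set} → (A → A → Bool) → List A → List A → Bool
allPairs g xs ys = all (λ x → all (g x) ys) xs

respects≡allPairs : ∀ {L : Set} eqL ltL (ls : List L) vs →
  respects eqL ltL ls vs ≡ allPairs (pairCheck eqL ltL) (zip ls vs) (zip ls vs)
respects≡allPairs eqL ltL ls vs = all-cartesianProduct _ (zip ls vs) (zip ls vs)

respects-shuffle : ∀ τ ν ℓ t c s → length τ ≡ length t → length ν ≡ length s →
  respects eqP ltP (map τl τ ++ ℓl ℓ ∷ map νl ν ++ []) (t ++ c ∷ s ++ []) ≡
  (matches τ t ∧ below c t) ∧ (matches ν s ∧ below c s)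
respects-shuffle τ ν ℓ t c s τt νs = begin
  respects eqP ltP ls vs                                 ≡⟨ respects≡allPairs eqP ltP ls vs ⟩
  allPairs g (zip ls vs) (zip ls vs)                     ≡⟨ cong (λ Z → allPairs g Z Z) zip-blocks ⟩
  allPairs g Z Z                                         ≡⟨ all-++ (λ x → all (g x) Z) Zτ (L ∷ Zν) ⟩
  allPairs g Zτ Z ∧ (all (g L) Z ∧ allPairs g Zν Z)      ≡⟨ cong₂ _∧_ rowτ (cong₂ _∧_ rowL rowν) ⟩
  (matches τ t ∧ below c t) ∧ (below c s ∧ matches ν s)
    ≡⟨ cong ((matches τ t ∧ below c t) ∧_) (∧-comm (below c s) (matches ν s)) ⟩
  (matches τ t ∧ below c t) ∧ (matches ν s ∧ below c s)  ∎
  where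
  open ≡-Reasoning
  ls : List PLetter
  ls = map τl τ ++ ℓl ℓ ∷ map νl ν ++ []
  vs : Word
  vs = t ++ c ∷ s ++ []
  g : PLetter × ℕ → PLetter × ℕ → Bool
  g = pairCheck eqP ltP
  chk : ℕ × ℕ → ℕ × ℕ → Bool
  chk = pairCheck _≡ᵇ_ _<ᵇ_
  tagτ tagν : ℕ × ℕ → PLetter × ℕ
  tagτ = map₁ τl
  tagν = map₁ νl
  Pτ Pν : List (ℕ × ℕ)
  Pτ = zip τ t
  Pν = zip ν s
  L : PLetter × ℕ
  L = ℓl ℓ , c
  Zτ Zν Z : List (PLetter × ℕ)
  Zτ = map tagτ Pτ
  Zν = map tagν Pν
  Z = Zτ ++ L ∷ Zν

  zip-blocks : zip ls vs ≡ Z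
  zip-blocks = trans (zip-++ (map τl τ) t (trans (length-map τl τ) τt))
                     (cong₂ (λ A B → A ++ L ∷ B) (zip-mapˡ τl τ t)
                            (trans (cong₂ zip (++-identityʳ (map νl ν)) (++-identityʳ s)) (zip-mapˡ νl ν s)))

  rowτ : allPairs g Zτ Z ≡ matches τ t ∧ below c t
  rowτ = begin
    all (λ x → all (g x) Z) Zτ                          ≡⟨ all-map (λ x → all (g x) Z) tagτ Pτ ⟩
    all (λ y → all (g (tagτ y)) Z) Pτ                   ≡⟨ all-cong entry Pτ ⟩
    all (λ y → all (chk y) Pτ ∧ (proj₂ y <ᵇ c)) Pτ      ≡⟨ all-∧ (λ y → all (chk y) Pτ) (λ y → proj₂ y <ᵇ c) Pτ ⟩
    allPairs chk Pτ Pτ ∧ all ((_<ᵇ c) ∘ proj₂) Pτ       ≡⟨ cong₂ _∧_ (sym (respects≡allPairs _≡ᵇ_ _<ᵇ_ τ t)) (all-zip-proj₂ (_<ᵇ c) τ t τt) ⟩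
    matches τ t ∧ below c t                             ∎
    where
    entry : ∀ y → all (g (tagτ y)) Z ≡ all (chk y) Pτ ∧ (proj₂ y <ᵇ c)
    entry y = begin
      all (g (tagτ y)) Z                                             ≡⟨ all-++ (g (tagτ y)) Zτ (L ∷ Zν) ⟩
      all (g (tagτ y)) Zτ ∧ ((proj₂ y <ᵇ c) ∧ all (g (tagτ y)) Zν)
        ≡⟨ cong₂ (λ a b → a ∧ ((proj₂ y <ᵇ c) ∧ b)) (all-map (g (tagτ y)) tagτ Pτ)
                 (trans (all-map (g (tagτ y)) tagν Pν) (all-true Pν)) ⟩
      all (chk y) Pτ ∧ ((proj₂ y <ᵇ c) ∧ true)                       ≡⟨ cong (all (chk y) Pτ ∧_) (∧-identityʳ _) ⟩
      all (chk y) Pτ ∧ (proj₂ y <ᵇ c)                                ∎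

  rowL : all (g L) Z ≡ true
  rowL = trans (all-++ (g L) Zτ (L ∷ Zν))
    (cong₂ _∧_ (trans (all-map (g L) tagτ Pτ) (all-true Pτ)) (cong₂ _∧_ LL (trans (all-map (g L) tagν Pν) (all-true Pν))))
    where
    LL : g L L ≡ true
    LL = trans (cong (λ b → (not (ℓ ≡ᵇ ℓ) ∨ b) ∧ true) (Equivalence.to T-≡ (≡⇒≡ᵇ c c refl))) (cong (_∧ true) (∨-zeroʳ _))

  rowν : allPairs g Zν Z ≡ below c s ∧ matches ν s
  rowν = begin
    all (λ x → all (g x) Z) Zν                          ≡⟨ all-map (λ x → all (g x) Z) tagν Pν ⟩
    all (λ y → all (g (tagν y)) Z) Pν                   ≡⟨ all-cong entry Pν ⟩
    all (λ y → (proj₂ y <ᵇ c) ∧ all (chk y) Pν) Pν      ≡⟨ all-∧ (λ y → proj₂ y <ᵇ c) (λ y → all (chk y) Pν) Pν ⟩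
    all ((_<ᵇ c) ∘ proj₂) Pν ∧ allPairs chk Pν Pν       ≡⟨ cong₂ _∧_ (all-zip-proj₂ (_<ᵇ c) ν s νs) (sym (respects≡allPairs _≡ᵇ_ _<ᵇ_ ν s)) ⟩
    below c s ∧ matches ν s                             ∎
    where
    entry : ∀ y → all (g (tagν y)) Z ≡ (proj₂ y <ᵇ c) ∧ all (chk y) Pν
    entry y = begin
      all (g (tagν y)) Z                                             ≡⟨ all-++ (g (tagν y)) Zτ (L ∷ Zν) ⟩
      all (g (tagν y)) Zτ ∧ ((proj₂ y <ᵇ c) ∧ all (g (tagν y)) Zν)
        ≡⟨ cong₂ (λ a b → a ∧ ((proj₂ y <ᵇ c) ∧ b)) (trans (all-map (g (tagν y)) tagτ Pτ) (all-true Pτ))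
                 (all-map (g (tagν y)) tagν Pν) ⟩
      (proj₂ y <ᵇ c) ∧ all (chk y) Pν                                ∎

module ShufflePattern (τ ν : Word) (ℓ : ℕ) where

  open Shuffle (length τ) (length ν) (matches τ) (matches ν)

  R : Word → Bool
  R = respects eqP ltP (map τl τ ++ ℓl ℓ ∷ map νl ν ++ [])

  νBlock : ∀ {n} → n ≡ length ν → ∀ t c → length τ ≡ length t → ∀ r →
    fits n r ∧ any (λ v → R (t ++ c ∷ take n r ++ v)) ([] ∷ []) ≡ matches τ t ∧ (below c t ∧ atν< c r)
  νBlock {q} refl t c τt r = by-cases (q ≤? length r)
    where
    Mτ = matches τ t
    Bτ = below c t
    s = take q r
    by-cases : Dec (q ≤ length r) → fits q r ∧ (R (t ++ c ∷ s ++ []) ∨ false) ≡ Mτ ∧ (Bτ ∧ atν< c r)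
    by-cases (yes q≤) = begin
      fits q r ∧ (R (t ++ c ∷ s ++ []) ∨ false)
        ≡⟨ cong (fits q r ∧_) (trans (∨-identityʳ _) (respects-shuffle τ ν ℓ t c s τt (sym (length-take-≤ r q≤)))) ⟩
      fits q r ∧ ((Mτ ∧ Bτ) ∧ (matches ν s ∧ below c s))
        ≡⟨ solve 5 (λ f a b x y → f :∧ ((a :∧ b) :∧ (x :∧ y)) := a :∧ (b :∧ (f :∧ (x :∧ y)))) refl
                 (fits q r) Mτ Bτ (matches ν s) (below c s) ⟩
      Mτ ∧ (Bτ ∧ atν< c r) ∎
      where
      open ≡-Reasoning
      open 𝔹-Solver
    by-cases (no q≰) = begin
      fits q r ∧ (R (t ++ c ∷ s ++ []) ∨ false)  ≡⟨ cong (_∧ (R (t ++ c ∷ s ++ []) ∨ false)) (fits-no r q≰) ⟩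
      false                                       ≡⟨ trans (cong (Mτ ∧_) (∧-zeroʳ Bτ)) (∧-zeroʳ Mτ) ⟨
      Mτ ∧ (Bτ ∧ false)
        ≡⟨ cong (λ b → Mτ ∧ (Bτ ∧ (b ∧ (matches ν s ∧ below c s)))) (fits-no r q≰) ⟨
      Mτ ∧ (Bτ ∧ atν< c r)                        ∎
      where open ≡-Reasoning

  ℓBlock : ∀ t → length τ ≡ length t → ∀ ρ →
    any (λ v → R (t ++ v)) (occs ((ℓl ℓ ∷ []) ∷ map νl ν ∷ []) ρ) ≡ matches τ t ∧ mid t ρ
  ℓBlock t τt ρ = trans (occs-∷ (λ v → R (t ++ v)) (ℓl ℓ ∷ []) (map νl ν ∷ []) ρ)
                        (trans (any-cong letter (suffixes ρ)) (any-∧ˡ (matches τ t) (midAt t) (suffixes ρ)))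
    where
    letter : ∀ ρ′ → fits 1 ρ′ ∧ any (λ v → R (t ++ take 1 ρ′ ++ v)) (occs (map νl ν ∷ []) (drop 1 ρ′))
                    ≡ matches τ t ∧ midAt t ρ′
    letter []      = sym (∧-zeroʳ _)
    letter (c ∷ r) = begin
      any (λ v → R (t ++ c ∷ v)) (occs (map νl ν ∷ []) r)
        ≡⟨ occs-∷ (λ v → R (t ++ c ∷ v)) (map νl ν) [] r ⟩
      anySuffix (λ r′ → fits (length (map νl ν)) r′ ∧ any (λ v → R (t ++ c ∷ take (length (map νl ν)) r′ ++ v)) ([] ∷ [])) r
        ≡⟨ any-cong (νBlock (length-map νl ν) t c τt) (suffixes r) ⟩
      anySuffix (λ r′ → matches τ t ∧ (below c t ∧ atν< c r′)) r
        ≡⟨ trans (any-∧ˡ (matches τ t) _ (suffixes r)) (cong (matches τ t ∧_) (any-∧ˡ (below c t) (atν< c) (suffixes r))) ⟩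
      matches τ t ∧ (below c t ∧ hasν< c r) ∎
      where open ≡-Reasoning

  τBlock : ∀ {n} → n ≡ length τ → ∀ σ →
    fits n σ ∧ any (λ v → R (take n σ ++ v)) (occs ((ℓl ℓ ∷ []) ∷ map νl ν ∷ []) (drop n σ)) ≡ atφ σ
  τBlock {p} refl σ = by-cases (p ≤? length σ)
    where
    t = take p σ
    occurrences = any (λ v → R (t ++ v)) (occs ((ℓl ℓ ∷ []) ∷ map νl ν ∷ []) (drop p σ))
    by-cases : Dec (p ≤ length σ) → fits p σ ∧ occurrences ≡ atφ σ
    by-cases (yes p≤) = cong (fits p σ ∧_) (ℓBlock t (sym (length-take-≤ σ p≤)) (drop p σ))
    by-cases (no p≰)  = trans (cong (_∧ occurrences) (fits-no σ p≰))
                              (sym (cong (_∧ (matches τ t ∧ mid t (drop p σ))) (fits-no σ p≰)))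

  contains-shuffle : ∀ σ → contains eqP ltP (shufflePattern τ ℓ ν) σ ≡ hasφ σ
  contains-shuffle σ = trans (occs-∷ R (map τl τ) ((ℓl ℓ ∷ []) ∷ map νl ν ∷ []) σ)
                             (any-cong (τBlock (length-map τl τ)) (suffixes σ))

module Recurrences (τ ν : Word) (ℓ j : ℕ) where

  open Shuffle (length τ) (length ν) (matches τ) (matches ν)
  open ShufflePattern τ ν ℓ using (contains-shuffle)

  k : ℕ
  k = suc j

  A : ℕ → FPS
  A m = Aφ τ ℓ ν m

  T V : FPS
  T = Aτ τ j
  V = Aτ ν j

  avoidsφ avoidsτ avoidsν avoidsν<k onlyτ : Word → ℤ
  avoidsφ σ   = 𝟙 (not (hasφ σ))
  avoidsτ σ   = 𝟙 (not (hasτ σ))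
  avoidsν σ   = 𝟙 (not (hasν σ))
  avoidsν<k σ = 𝟙 (not (hasν< k σ))
  onlyτ σ     = 𝟙 (not (hasφ σ) ∧ hasτ σ)

  Q B : FPS
  Q = gf j onlyτ
  B = gf k avoidsν<k

  A≗gf : ∀ m → A m ≗ gf m avoidsφ
  A≗gf m n = trans (avoidCount≡Σ𝟙 eqP ltP (shufflePattern τ ℓ ν) n m)
                   (Σ∈-cong (words m n) (cong (𝟙 ∘ not) ∘ contains-shuffle))

  Aτ≗gf : ∀ π → Aτ π j ≗ gf j (λ σ → 𝟙 (not (anySuffix (startsWith (length π) (matches π)) σ)))
  Aτ≗gf π n = trans (avoidCount≡Σ𝟙 _≡ᵇ_ _<ᵇ_ (π ∷ []) n j) (Σ∈-cong (words j n) (cong (𝟙 ∘ not) ∘ contains-block π))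

  P-split : A j ≗ Q ⊕ T
  P-split = begin
    A j                               ≈⟨ A≗gf j ⟩
    gf j avoidsφ                      ≈⟨ (λ n → Σ∈-cong (words j n) 𝟙-avoidsφ) ⟩
    gf j (λ u → onlyτ u + avoidsτ u)  ≈⟨ (λ n → Σ∈-+ (words j n) onlyτ avoidsτ) ⟩
    Q ⊕ gf j avoidsτ                  ≈⟨ ⊕-congʳ Q (Aτ≗gf τ) ⟨
    Q ⊕ T                             ∎
    where open ≗-Reasoning

  B-rec : B ≗ V ⊕ X* (V ⊛ B)
  B-rec = begin
    B                                                          ≈⟨ gf-split j avoidsν<k ⟩
    gf j avoidsν<k ⊕ gfAtTop j (λ u v → avoidsν<k (u ++ k ∷ v))
      ≈⟨ ⊕-cong (gf-cong-< j (cong (𝟙 ∘ not) ∘ hasν<-below _)) (gfAtTop-cong j (λ u<k _ → 𝟙-avoidsν<-++-top _ _ u<k)) ⟩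
    gf j avoidsν ⊕ gfAtTop j (λ u v → avoidsν u * avoidsν<k v) ≈⟨ ⊕-cong (sym ∘ Aτ≗gf ν) (gfAtTop-* j avoidsν avoidsν<k) ⟩
    V ⊕ X* (gf j avoidsν ⊛ B)                                  ≈⟨ ⊕-congʳ V (X*-cong (⊛-congˡ B (Aτ≗gf ν))) ⟨
    V ⊕ X* (V ⊛ B)                                             ∎
    where open ≗-Reasoning

  A-rec : A k ≗ A j ⊕ X* (Q ⊛ B) ⊕ X* (T ⊛ A k)
  A-rec = begin
    A k                                                        ≈⟨ A≗gf k ⟩
    gf k avoidsφ                                               ≈⟨ gf-split j avoidsφ ⟩
    gf j avoidsφ ⊕ gfAtTop j (λ u v → avoidsφ (u ++ k ∷ v))
      ≈⟨ ⊕-cong (sym ∘ A≗gf j) (gfAtTop-cong j (𝟙-avoidsφ-++-top _ _)) ⟩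
    A j ⊕ gfAtTop j (λ u v → onlyτ u * avoidsν<k v + avoidsτ u * avoidsφ v)
      ≈⟨ ⊕-congʳ (A j) (gfAtTop-+ j (λ u v → onlyτ u * avoidsν<k v) (λ u v → avoidsτ u * avoidsφ v)) ⟩
    A j ⊕ (gfAtTop j (λ u v → onlyτ u * avoidsν<k v) ⊕ gfAtTop j (λ u v → avoidsτ u * avoidsφ v))
      ≈⟨ ⊕-congʳ (A j) (⊕-cong (gfAtTop-* j onlyτ avoidsν<k) (gfAtTop-* j avoidsτ avoidsφ)) ⟩
    A j ⊕ (X* (Q ⊛ B) ⊕ X* (gf j avoidsτ ⊛ gf k avoidsφ))
      ≈⟨ ⊕-congʳ (A j) (⊕-congʳ (X* (Q ⊛ B)) (X*-cong (⊛-cong (Aτ≗gf τ) (A≗gf k)))) ⟨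
    A j ⊕ (X* (Q ⊛ B) ⊕ X* (T ⊛ A k))                          ≈⟨ (λ n → ℤ.+-assoc (A j n) (X* (Q ⊛ B) n) (X* (T ⊛ A k) n)) ⟨
    A j ⊕ X* (Q ⊛ B) ⊕ X* (T ⊛ A k)                            ∎
    where open ≗-Reasoning

  A-closedForm : ((one ⊖ X* T) ⊛ (one ⊖ X* V)) ⊛ A k ≗ A j ⊖ X* (T ⊛ V)
  A-closedForm = closedForm {A k} {B} {A j} {Q} {T} {V} A-rec B-rec P-split

mainTheorem3 : (a b ℓ : ℕ) (τ ν : Word) →
    IsGenPattern a τ → IsGenPattern b ν → a < ℓ → b < ℓ →
    (k : ℕ) → ℓ ≤ k → (n : ℕ) →
    Aφ τ ℓ ν k n ≡
      (inv ((one ⊖ X* (Aτ τ (k ∸ 1))) ⊛ (one ⊖ X* (Aτ ν (k ∸ 1))))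
        ⊛ (Aφ τ ℓ ν (k ∸ 1) ⊖ X* (Aτ τ (k ∸ 1) ⊛ Aτ ν (k ∸ 1)))) n
mainTheorem3 a b ℓ τ ν _ _ a<ℓ _ zero ℓ≤0 n = ⊥-elim (ℕ.n≮0 (ℕ.<-≤-trans a<ℓ ℓ≤0))
mainTheorem3 a b ℓ τ ν _ _ _ _ (suc j) _ n =
  d⊛a≗r⇒a≗inv[d]⊛r ((one ⊖ X* T) ⊛ (one ⊖ X* V)) {A k} refl A-closedForm n
  where open Recurrences τ ν ℓ j
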